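{- Let $d\geq 2$, let $\alpha_1,\dots,\alpha_d\in\mathbb Z$ with $\alpha_d\neq 0$, and let $s\in\mathbb N^{\mathbb N}$ satisfy $s(n+d)+\alpha_1s(n+d-1)+\dots+\alpha_ds(n)=0$ for all $n\geq0$. Let $B(X)=\alpha_d+\alpha_{d-1}X+\dots+\alpha_1X^{d-1}+X^d$, let $S_{d-1}(X)=s(d-1)+s(d-2)X+\dots+s(0)X^{d-1}$, and let $A(X)$ be the quotient of $B(X)S_{d-1}(X)$ upon division by $X^d$ (i.e. the unique polynomial with $B(X)S_{d-1}(X)=C(X)+X^dA(X)$ and $\deg C<d$). Then there is $n_0$ such that, for every sufficiently large $b\in\mathbb N$, $$s(n)=\left\lfloor\frac{\left(b^{n(d-2)+\lceil n/2\rceil}+b^{n^2}A(b^n)\right)\bmod B(b^n)}{b^{n(d-1)}}\right\rfloor\quad\text{for all } n\geq n_0.$$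
   Context: $\mathbb N=\{0,1,2,\dots\}$. For integers $x$ and $y\neq0$, $x\bmod y$ denotes the unique integer $m$ with $0\leq m<|y|$ and $y\mid x-m$ (so it is nonnegative even when $x$ is negative), and $\lfloor\cdot\rfloor$ is the floor function. -}

module Defs where

open import Data.Nat as ℕ using (ℕ; zero; suc)
open import Data.Integer as ℤ using (ℤ; +_)
open import Data.Integer.DivMod using (_%ℕ_)
open import Data.List using (List; []; _∷_; map; foldr; upTo; drop; _++_)

sumℤ : List ℤ → ℤ
sumℤ = foldr ℤ._+_ (+ 0)

-- polynomials with integer coefficients, lowest degree first
addP : List ℤ → List ℤ → List ℤ
addP [] q = q
addP (a ∷ p) [] = a ∷ p
addP (a ∷ p) (b ∷ q) = (a ℤ.+ b) ∷ addP p q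

mulP : List ℤ → List ℤ → List ℤ
mulP [] q = []
mulP (a ∷ p) q = addP (map (a ℤ.*_) q) (+ 0 ∷ mulP p q)

evalP : List ℤ → ℤ → ℤ
evalP [] x = + 0
evalP (c ∷ cs) x = c ℤ.+ x ℤ.* evalP cs x

-- B(X) = α_d + α_{d-1} X + ... + α_1 X^{d-1} + X^d  (α i = α_i, i = 1..d)
Bpoly : ℕ → (ℕ → ℤ) → List ℤ
Bpoly d α = map (λ k → α (d ℕ.∸ k)) (upTo d) ++ (+ 1 ∷ [])

-- S_{d-1}(X) = s(d-1) + s(d-2) X + ... + s(0) X^{d-1}
Spoly : ℕ → (ℕ → ℕ) → List ℤ
Spoly d s = map (λ k → + s (d ℕ.∸ 1 ℕ.∸ k)) (upTo d)

Apoly : ℕ → (ℕ → ℤ) → (ℕ → ℕ) → List ℤ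
Apoly d α s = drop d (mulP (Bpoly d α) (Spoly d s))

-- x mod y  (nonnegative, 0 ≤ m < |y|); junk value 0 when y = 0
modℤ : ℤ → ℤ → ℕ
modℤ x y with ℤ.∣ y ∣
... | zero = 0
... | suc k = x %ℕ suc k

-- floor division of naturals; junk value 0 when divisor is 0
divℕ : ℕ → ℕ → ℕ
divℕ x zero = 0
divℕ x (suc k) = x ℕ./ suc k

Recurrence : ℕ → (ℕ → ℤ) → (ℕ → ℕ) → Set
Recurrence d α s = ∀ n →
  + s (n ℕ.+ d) ℤ.+ sumℤ (map (λ k → α (suc k) ℤ.* + s (n ℕ.+ d ℕ.∸ suc k)) (upTo d)) ≡ + 0
  where open import Relation.Binary.PropositionalEquality using (_≡_)

module Submission where

-- With T n (X) = s 0 X^(n-1) + ... + s (n-1)  (horner X s n), the expansion A(X)/B(X) = Σ s k X^(-k-1)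
-- becomes the identity X^n A(X) = T n (X) B(X) + A n (X), where A n is A built from the shifted
-- sequence s (n + _). As s grows at most like L^n with L = 1 + Σ ∣α i∣, at X = b^n we get
-- A n (X) = s n X^(d-1) + E with ∣E∣ ≤ K L^n X^(d-2), K constant. Once b > (K L)^2 the offset
-- b^(n(d-2)+⌈n/2⌉) = X^(d-2) b^⌈n/2⌉ dominates E, so offset + X^n A(X) is congruent modulo B(X)
-- to s n X^(d-1) + ρ with 0 ≤ ρ < X^(d-1); this is also below B(X) ≥ X^d - L X^(d-1), hence it
-- is the remainder, and the floor division by X^(d-1) returns s n.

open import Defs
open import Data.Nat using (ℕ; _+_; _*_; _∸_; _^_; _≥_; ⌈_/2⌉)
open import Data.Integer as ℤ using (ℤ; +_)
open import Data.Product using (Σ; _×_)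
open import Relation.Binary.PropositionalEquality using (_≡_; _≢_)

open import Function using (_∘_)
open import Data.Nat using (zero; suc; _≤_; _<_; z≤n; s≤s; z<s; s<s; ⌊_/2⌋; _<?_; NonZero; >-nonZero)
open import Data.Nat.Properties
open import Data.Nat.Induction using (<-rec)
open import Data.Nat.DivMod using (_/_; _%_; m*n/n≡m; m<n⇒m/n≡0; +-distrib-/-∣ˡ; [m+kn]%n≡m%n; m<n⇒m%n≡m)
open import Data.Nat.Divisibility using (divides-refl)
open import Data.Integer using (-[1+_]; ∣_∣)
import Data.Integer.Properties as ℤₚ
open import Data.List using ([]; _∷_; map; drop; _++_; applyUpTo; upTo)
open import Data.List.Properties using (drop-map; map-upTo)
open import Data.Product using (_,_)
open import Relation.Nullary using (yes; no)
open import Relation.Binary.PropositionalEquality using (refl; sym; trans; cong; cong₂; subst; module ≡-Reasoning)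
open import Algebra.Properties.CommutativeSemigroup *-commutativeSemigroup using (x∙yz≈y∙xz)
open import Algebra.Properties.AbelianGroup ℤₚ.+-0-abelianGroup using (inverseˡ-unique)
open import Data.Integer.Tactic.RingSolver using (solve-∀)
open import Data.Nat.Tactic.RingSolver using () renaming (solve-∀ to solveℕ-∀)

^-distribʳ-* : ∀ m n o → (m * n) ^ o ≡ m ^ o * n ^ o
^-distribʳ-* m n zero    = refl
^-distribʳ-* m n (suc o) = trans (cong (m * n *_) (^-distribʳ-* m n o)) (shuffle m n (m ^ o) (n ^ o))
  where
  shuffle : ∀ a b p q → a * b * (p * q) ≡ a * p * (b * q)
  shuffle = solveℕ-∀

m≤m^[1+n] : ∀ m n → m ≤ m ^ suc n
m≤m^[1+n] zero    n = z≤n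
m≤m^[1+n] (suc m) n = m≤m*n (suc m) (suc m ^ n) {{m^n≢0 (suc m) n}}

pos-+-small : ∀ {a} E → ∣ E ∣ ≤ a → Σ ℕ λ ρ → (+ a ℤ.+ E ≡ + ρ) × (a ∸ ∣ E ∣ ≤ ρ) × (ρ ≤ a + ∣ E ∣)
pos-+-small {a} (+ u)    _   = a + u , sym (ℤₚ.pos-+ a u) , ≤-trans (m∸n≤m a u) (m≤m+n a u) , ≤-refl
pos-+-small {a} -[1+ u ] u<a = a ∸ suc u , ℤₚ.⊖-≥ u<a , ≤-refl , ≤-trans (m∸n≤m a (suc u)) (m≤m+n a (suc u))

mod-div-digit : ∀ q u ρ {Y N} → ρ < Y → u * Y + ρ < N →
                divℕ (modℤ (+ q ℤ.* + N ℤ.+ + (u * Y + ρ)) (+ N)) Y ≡ u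
mod-div-digit q u ρ {Y@(suc _)} {N@(suc _)} ρ<Y digit<N = begin
    divℕ (modℤ (+ q ℤ.* + N ℤ.+ + (u * Y + ρ)) (+ N)) Y
  ≡⟨ cong (λ v → divℕ (modℤ v (+ N)) Y) (ℤₚ.+-comm (+ q ℤ.* + N) (+ (u * Y + ρ))) ⟩
    divℕ (modℤ (+ (u * Y + ρ) ℤ.+ + q ℤ.* + N) (+ N)) Y
  ≡⟨ cong (λ v → divℕ (modℤ (+ (u * Y + ρ) ℤ.+ v) (+ N)) Y) (ℤₚ.pos-* q N) ⟨
    divℕ (modℤ (+ (u * Y + ρ) ℤ.+ + (q * N)) (+ N)) Y
  ≡⟨ cong (λ v → divℕ (modℤ v (+ N)) Y) (ℤₚ.pos-+ (u * Y + ρ) (q * N)) ⟨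
    (u * Y + ρ + q * N) % N / Y
  ≡⟨ cong (_/ Y) (trans ([m+kn]%n≡m%n (u * Y + ρ) q N) (m<n⇒m%n≡m digit<N)) ⟩
    (u * Y + ρ) / Y
  ≡⟨ +-distrib-/-∣ˡ ρ (divides-refl u) ⟩
    u * Y / Y + ρ / Y
  ≡⟨ cong₂ _+_ (m*n/n≡m u Y) (m<n⇒m/n≡0 ρ<Y) ⟩
    u + 0
  ≡⟨ +-identityʳ u ⟩
    u ∎
  where open ≡-Reasoning

pos-*-+ : ∀ a b c → + (a * b + c) ≡ + a ℤ.* + b ℤ.+ + c
pos-*-+ a b c = trans (ℤₚ.pos-+ (a * b) c) (cong (ℤ._+ + c) (ℤₚ.pos-* a b))

∑ : ℕ → (ℕ → ℤ) → ℤ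
∑ m f = sumℤ (applyUpTo f m)

∑-cong : ∀ m {f g : ℕ → ℤ} → (∀ {i} → i < m → f i ≡ g i) → ∑ m f ≡ ∑ m g
∑-cong zero    eq = refl
∑-cong (suc m) eq = cong₂ ℤ._+_ (eq z<s) (∑-cong m (eq ∘ s<s))

∑-distrib-+ : ∀ m (f g : ℕ → ℤ) → ∑ m (λ i → f i ℤ.+ g i) ≡ ∑ m f ℤ.+ ∑ m g
∑-distrib-+ zero    f g = refl
∑-distrib-+ (suc m) f g =
  trans (cong (ℤ._+_ (f 0 ℤ.+ g 0)) (∑-distrib-+ m (f ∘ suc) (g ∘ suc)))
        (shuffle (f 0) (g 0) (∑ m (f ∘ suc)) (∑ m (g ∘ suc)))
  where
  shuffle : ∀ a b c d → a ℤ.+ b ℤ.+ (c ℤ.+ d) ≡ a ℤ.+ c ℤ.+ (b ℤ.+ d)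
  shuffle = solve-∀

∑-distribˡ-* : ∀ m c (f : ℕ → ℤ) → ∑ m (λ i → c ℤ.* f i) ≡ c ℤ.* ∑ m f
∑-distribˡ-* zero    c f = sym (ℤₚ.*-zeroʳ c)
∑-distribˡ-* (suc m) c f =
  trans (cong (ℤ._+_ (c ℤ.* f 0)) (∑-distribˡ-* m c (f ∘ suc))) (sym (ℤₚ.*-distribˡ-+ c (f 0) _))

∑-snoc : ∀ m (f : ℕ → ℤ) → ∑ (suc m) f ≡ ∑ m f ℤ.+ f m
∑-snoc zero    f = ℤₚ.+-comm (f 0) (+ 0)
∑-snoc (suc m) f = trans (cong (ℤ._+_ (f 0)) (∑-snoc m (f ∘ suc))) (sym (ℤₚ.+-assoc (f 0) _ _))

∑-reverse : ∀ m (f : ℕ → ℤ) → ∑ m f ≡ ∑ m (λ i → f (m ∸ suc i))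
∑-reverse zero    f = refl
∑-reverse (suc m) f =
  trans (∑-snoc m f) (trans (ℤₚ.+-comm (∑ m f) (f m)) (cong (ℤ._+_ (f m)) (∑-reverse m f)))

∑ℕ : ℕ → (ℕ → ℕ) → ℕ
∑ℕ zero    f = 0
∑ℕ (suc m) f = f 0 + ∑ℕ m (f ∘ suc)

≤-∑ℕ : ∀ {m k} (f : ℕ → ℕ) → k < m → f k ≤ ∑ℕ m f
≤-∑ℕ {suc m} {zero}  f _         = m≤m+n (f 0) _
≤-∑ℕ {suc m} {suc k} f (s<s k<m) = ≤-trans (≤-∑ℕ (f ∘ suc) k<m) (m≤n+m _ (f 0))

∣∑*∣≤∑∣∣* : ∀ m (β : ℕ → ℤ) (f : ℕ → ℕ) {G} → (∀ {i} → i < m → f i ≤ G) →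
              ∣ ∑ m (λ i → β i ℤ.* + f i) ∣ ≤ ∑ℕ m (λ i → ∣ β i ∣) * G
∣∑*∣≤∑∣∣* zero    β f f≤G = z≤n
∣∑*∣≤∑∣∣* (suc m) β f {G} f≤G = begin
    ∣ β 0 ℤ.* + f 0 ℤ.+ ∑ m (λ i → β (suc i) ℤ.* + f (suc i)) ∣
  ≤⟨ ℤₚ.∣i+j∣≤∣i∣+∣j∣ (β 0 ℤ.* + f 0) _ ⟩
    ∣ β 0 ℤ.* + f 0 ∣ + ∣ ∑ m (λ i → β (suc i) ℤ.* + f (suc i)) ∣
  ≤⟨ +-mono-≤ (≤-reflexive (ℤₚ.abs-* (β 0) (+ f 0))) (∣∑*∣≤∑∣∣* m (β ∘ suc) (f ∘ suc) (f≤G ∘ s<s)) ⟩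
    ∣ β 0 ∣ * f 0 + ∑ℕ m (λ i → ∣ β (suc i) ∣) * G
  ≤⟨ +-monoˡ-≤ _ (*-monoʳ-≤ ∣ β 0 ∣ (f≤G z<s)) ⟩
    ∣ β 0 ∣ * G + ∑ℕ m (λ i → ∣ β (suc i) ∣) * G
  ≡⟨ *-distribʳ-+ G ∣ β 0 ∣ _ ⟨
    ∑ℕ (suc m) (λ i → ∣ β i ∣) * G ∎
  where open ≤-Reasoning

evalP-addP : ∀ p q x → evalP (addP p q) x ≡ evalP p x ℤ.+ evalP q x
evalP-addP []      q       x = sym (ℤₚ.+-identityˡ _)
evalP-addP (a ∷ p) []      x = sym (ℤₚ.+-identityʳ _)
evalP-addP (a ∷ p) (b ∷ q) x =
  trans (cong (λ v → a ℤ.+ b ℤ.+ x ℤ.* v) (evalP-addP p q x)) (shuffle a b (evalP p x) (evalP q x) x)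
  where
  shuffle : ∀ a b u v x → a ℤ.+ b ℤ.+ x ℤ.* (u ℤ.+ v) ≡ a ℤ.+ x ℤ.* u ℤ.+ (b ℤ.+ x ℤ.* v)
  shuffle = solve-∀

evalP-map-* : ∀ c p x → evalP (map (c ℤ.*_) p) x ≡ c ℤ.* evalP p x
evalP-map-* c []      x = sym (ℤₚ.*-zeroʳ c)
evalP-map-* c (a ∷ p) x =
  trans (cong (λ v → c ℤ.* a ℤ.+ x ℤ.* v) (evalP-map-* c p x)) (shuffle c a (evalP p x) x)
  where
  shuffle : ∀ c a u x → c ℤ.* a ℤ.+ x ℤ.* (c ℤ.* u) ≡ c ℤ.* (a ℤ.+ x ℤ.* u)
  shuffle = solve-∀

addP-identityʳ : ∀ p → addP p [] ≡ p
addP-identityʳ []      = refl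
addP-identityʳ (a ∷ p) = refl

drop-addP : ∀ k p q → drop k (addP p q) ≡ addP (drop k p) (drop k q)
drop-addP zero    p       q       = refl
drop-addP (suc k) []      q       = refl
drop-addP (suc k) (a ∷ p) []      = sym (addP-identityʳ (drop k p))
drop-addP (suc k) (a ∷ p) (b ∷ q) = drop-addP k p q

evalP-drop-mulP : ∀ m (β : ℕ → ℤ) c q x →
                  evalP (drop m (mulP (applyUpTo β m ++ c ∷ []) q)) x
                  ≡ ∑ m (λ i → β i ℤ.* evalP (drop (m ∸ i) q) x) ℤ.+ c ℤ.* evalP q x
evalP-drop-mulP zero β c q x = begin
    evalP (addP (map (c ℤ.*_) q) (+ 0 ∷ [])) x
  ≡⟨ evalP-addP (map (c ℤ.*_) q) (+ 0 ∷ []) x ⟩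
    evalP (map (c ℤ.*_) q) x ℤ.+ (+ 0 ℤ.+ x ℤ.* + 0)
  ≡⟨ cong₂ ℤ._+_ (evalP-map-* c q x) (zero-term x) ⟩
    c ℤ.* evalP q x ℤ.+ + 0
  ≡⟨ ℤₚ.+-comm (c ℤ.* evalP q x) (+ 0) ⟩
    + 0 ℤ.+ c ℤ.* evalP q x ∎
  where
  open ≡-Reasoning
  zero-term : ∀ x → + 0 ℤ.+ x ℤ.* + 0 ≡ + 0
  zero-term = solve-∀
evalP-drop-mulP (suc m) β c q x = begin
    evalP (drop (suc m) (addP (map (β 0 ℤ.*_) q) (+ 0 ∷ rest))) x
  ≡⟨ cong (λ p → evalP p x) (drop-addP (suc m) (map (β 0 ℤ.*_) q) (+ 0 ∷ rest)) ⟩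
    evalP (addP (drop (suc m) (map (β 0 ℤ.*_) q)) (drop m rest)) x
  ≡⟨ evalP-addP (drop (suc m) (map (β 0 ℤ.*_) q)) (drop m rest) x ⟩
    evalP (drop (suc m) (map (β 0 ℤ.*_) q)) x ℤ.+ evalP (drop m rest) x
  ≡⟨ cong₂ ℤ._+_ (trans (cong (λ p → evalP p x) (drop-map (suc m) q)) (evalP-map-* (β 0) (drop (suc m) q) x))
                 (evalP-drop-mulP m (β ∘ suc) c q x) ⟩
    β 0 ℤ.* evalP (drop (suc m) q) x ℤ.+ (∑ m (λ i → β (suc i) ℤ.* evalP (drop (m ∸ i) q) x) ℤ.+ c ℤ.* evalP q x)
  ≡⟨ ℤₚ.+-assoc (β 0 ℤ.* evalP (drop (suc m) q) x) _ _ ⟨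
    ∑ (suc m) (λ i → β i ℤ.* evalP (drop (suc m ∸ i) q) x) ℤ.+ c ℤ.* evalP q x ∎
  where
  open ≡-Reasoning
  rest = mulP (applyUpTo (β ∘ suc) m ++ c ∷ []) q

evalP-applyUpTo-++ : ∀ X m (f : ℕ → ℤ) r →
                     evalP (applyUpTo f m ++ r) (+ X) ≡ ∑ m (λ i → f i ℤ.* + (X ^ i)) ℤ.+ + (X ^ m) ℤ.* evalP r (+ X)
evalP-applyUpTo-++ X zero    f r = sym (trans (ℤₚ.+-identityˡ _) (ℤₚ.*-identityˡ _))
evalP-applyUpTo-++ X (suc m) f r = begin
    f 0 ℤ.+ + X ℤ.* evalP (applyUpTo (f ∘ suc) m ++ r) (+ X)
  ≡⟨ cong (λ v → f 0 ℤ.+ + X ℤ.* v) (evalP-applyUpTo-++ X m (f ∘ suc) r) ⟩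
    f 0 ℤ.+ + X ℤ.* (S ℤ.+ + (X ^ m) ℤ.* evalP r (+ X))
  ≡⟨ shuffle (f 0) (+ X) S (+ (X ^ m)) (evalP r (+ X)) ⟩
    f 0 ℤ.* + 1 ℤ.+ (+ X ℤ.* S ℤ.+ (+ X ℤ.* + (X ^ m)) ℤ.* evalP r (+ X))
  ≡⟨ cong₂ (λ u v → f 0 ℤ.* + 1 ℤ.+ (u ℤ.+ v ℤ.* evalP r (+ X)))
           (sym (trans (∑-cong m (λ {i} _ → shift-power (f (suc i)) i)) (∑-distribˡ-* m (+ X) _)))
           (sym (ℤₚ.pos-* X (X ^ m))) ⟩
    f 0 ℤ.* + 1 ℤ.+ (∑ m (λ i → f (suc i) ℤ.* + (X ^ suc i)) ℤ.+ + (X ^ suc m) ℤ.* evalP r (+ X))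
  ≡⟨ ℤₚ.+-assoc (f 0 ℤ.* + 1) _ _ ⟨
    ∑ (suc m) (λ i → f i ℤ.* + (X ^ i)) ℤ.+ + (X ^ suc m) ℤ.* evalP r (+ X) ∎
  where
  open ≡-Reasoning
  S = ∑ m (λ i → f (suc i) ℤ.* + (X ^ i))
  shuffle : ∀ a x s p e → a ℤ.+ x ℤ.* (s ℤ.+ p ℤ.* e) ≡ a ℤ.* + 1 ℤ.+ (x ℤ.* s ℤ.+ (x ℤ.* p) ℤ.* e)
  shuffle = solve-∀
  shift-power : ∀ a i → a ℤ.* + (X ^ suc i) ≡ + X ℤ.* (a ℤ.* + (X ^ i))
  shift-power a i = trans (cong (a ℤ.*_) (ℤₚ.pos-* X (X ^ i))) (commute a (+ X) (+ (X ^ i)))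
    where
    commute : ∀ a x p → a ℤ.* (x ℤ.* p) ≡ x ℤ.* (a ℤ.* p)
    commute = solve-∀

drop-applyUpTo : ∀ {A : Set} j i (g : ℕ → A) → drop j (applyUpTo g (j + i)) ≡ applyUpTo (g ∘ _+_ j) i
drop-applyUpTo zero    i g = refl
drop-applyUpTo (suc j) i g = drop-applyUpTo j i (g ∘ suc)

horner : ℕ → (ℕ → ℕ) → ℕ → ℕ
horner X t zero    = 0
horner X t (suc i) = X * horner X t i + t i

horner-shift : ∀ X t i → X * horner X t i + t i ≡ t 0 * X ^ i + horner X (t ∘ suc) i
horner-shift X t zero    = base X (t 0)
  where
  base : ∀ X a → X * 0 + a ≡ a * 1 + 0
  base = solveℕ-∀
horner-shift X t (suc i) = begin
    X * (X * horner X t i + t i) + t (suc i)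
  ≡⟨ cong (λ v → X * v + t (suc i)) (horner-shift X t i) ⟩
    X * (t 0 * X ^ i + horner X (t ∘ suc) i) + t (suc i)
  ≡⟨ shuffle X (t 0) (X ^ i) (horner X (t ∘ suc) i) (t (suc i)) ⟩
    t 0 * (X * X ^ i) + (X * horner X (t ∘ suc) i + t (suc i)) ∎
  where
  open ≡-Reasoning
  shuffle : ∀ X a p h b → X * (a * p + h) + b ≡ a * (X * p) + (X * h + b)
  shuffle = solveℕ-∀

horner-≤ : ∀ {X G i j} (t : ℕ → ℕ) → 1 ≤ X → i ≤ suc j → (∀ {k} → k < i → t k ≤ G) →
           horner X t i ≤ i * G * X ^ j
horner-≤ {i = zero}                 t _   _                 _   = z≤n
horner-≤ {X} {G} {suc zero} {j}     t 1≤X _                 t≤G = begin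
    X * 0 + t 0
  ≡⟨ cong (_+ t 0) (*-zeroʳ X) ⟩
    t 0
  ≤⟨ t≤G z<s ⟩
    G
  ≤⟨ m≤m*n G (X ^ j) {{m^n≢0 X j {{>-nonZero 1≤X}}}} ⟩
    G * X ^ j
  ≡⟨ cong (_* X ^ j) (+-identityʳ G) ⟨
    1 * G * X ^ j ∎
  where open ≤-Reasoning
horner-≤ {X} {G} {suc (suc i)} {suc j} t 1≤X (s≤s i<j) t≤G = begin
    X * horner X t (suc i) + t (suc i)
  ≤⟨ +-mono-≤ (*-monoʳ-≤ X (horner-≤ t 1≤X i<j (t≤G ∘ m<n⇒m<1+n))) (t≤G ≤-refl) ⟩
    X * (suc i * G * X ^ j) + G
  ≤⟨ +-monoʳ-≤ (X * (suc i * G * X ^ j)) (m≤m*n G (X ^ suc j) {{m^n≢0 X (suc j) {{>-nonZero 1≤X}}}}) ⟩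
    X * (suc i * G * X ^ j) + G * X ^ suc j
  ≡⟨ regroup X i G (X ^ j) ⟩
    suc (suc i) * G * X ^ suc j ∎
  where
  open ≤-Reasoning
  regroup : ∀ X i G p → X * (suc i * G * p) + G * (X * p) ≡ suc (suc i) * G * (X * p)
  regroup = solveℕ-∀

evalP-reversed≡horner : ∀ X i (h : ℕ → ℤ) (t : ℕ → ℕ) → (∀ {k} → k < i → h k ≡ + t (i ∸ suc k)) →
                        evalP (applyUpTo h i) (+ X) ≡ + horner X t i
evalP-reversed≡horner X zero    h t digit = refl
evalP-reversed≡horner X (suc i) h t digit = begin
    h 0 ℤ.+ + X ℤ.* evalP (applyUpTo (h ∘ suc) i) (+ X)
  ≡⟨ cong₂ (λ u v → u ℤ.+ + X ℤ.* v) (digit z<s) (evalP-reversed≡horner X i (h ∘ suc) t (digit ∘ s<s)) ⟩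
    + t i ℤ.+ + X ℤ.* + horner X t i
  ≡⟨ ℤₚ.+-comm (+ t i) (+ X ℤ.* + horner X t i) ⟩
    + X ℤ.* + horner X t i ℤ.+ + t i
  ≡⟨ pos-*-+ X (horner X t i) (t i) ⟨
    + horner X t (suc i) ∎
  where open ≡-Reasoning

evalP-drop-Spoly : ∀ j i s X → evalP (drop j (Spoly (j + i) s)) (+ X) ≡ + horner X s i
evalP-drop-Spoly j i s X = begin
    evalP (drop j (map digit (upTo (j + i)))) (+ X)
  ≡⟨ cong (λ p → evalP (drop j p) (+ X)) (map-upTo digit (j + i)) ⟩
    evalP (drop j (applyUpTo digit (j + i))) (+ X)
  ≡⟨ cong (λ p → evalP p (+ X)) (drop-applyUpTo j i digit) ⟩
    evalP (applyUpTo (digit ∘ _+_ j) i) (+ X)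
  ≡⟨ evalP-reversed≡horner X i (digit ∘ _+_ j) s (λ {k} _ → cong (+_ ∘ s) (index k)) ⟩
    + horner X s i ∎
  where
  open ≡-Reasoning
  digit : ℕ → ℤ
  digit k = + s (j + i ∸ 1 ∸ k)
  index : ∀ k → j + i ∸ 1 ∸ (j + k) ≡ i ∸ suc k
  index k = begin
      j + i ∸ 1 ∸ (j + k)
    ≡⟨ ∸-+-assoc (j + i) 1 (j + k) ⟩
      j + i ∸ suc (j + k)
    ≡⟨ cong (j + i ∸_) (+-suc j k) ⟨
      j + i ∸ (j + suc k)
    ≡⟨ [m+n]∸[m+o]≡n∸o j i (suc k) ⟩
      i ∸ suc k ∎

module LinearRecurrence (d : ℕ) (α : ℕ → ℤ) where

  β : ℕ → ℤ
  β i = α (d ∸ i)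

  -- B applied to a sequence, each X ^ i replaced by f i: thus B(X) = B⟨ X ^_ ⟩,
  -- the recurrence reads B⟨ s (n + _) ⟩ = 0, and A(X) = B⟨ horner X s ⟩.
  B⟨_⟩ : (ℕ → ℤ) → ℤ
  B⟨ f ⟩ = f d ℤ.+ ∑ d (λ i → β i ℤ.* f i)

  B⟨⟩-cong : ∀ {f g : ℕ → ℤ} → (∀ i → f i ≡ g i) → B⟨ f ⟩ ≡ B⟨ g ⟩
  B⟨⟩-cong f≗g = cong₂ ℤ._+_ (f≗g d) (∑-cong d (λ {i} _ → cong (β i ℤ.*_) (f≗g i)))

  B⟨⟩-linear : ∀ a (f g : ℕ → ℤ) → B⟨ (λ i → a ℤ.* f i ℤ.+ g i) ⟩ ≡ a ℤ.* B⟨ f ⟩ ℤ.+ B⟨ g ⟩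
  B⟨⟩-linear a f g = begin
      a ℤ.* f d ℤ.+ g d ℤ.+ ∑ d (λ i → β i ℤ.* (a ℤ.* f i ℤ.+ g i))
    ≡⟨ cong (ℤ._+_ (a ℤ.* f d ℤ.+ g d)) (trans (∑-cong d (λ {i} _ → distribute (β i) a (f i) (g i)))
                                                (∑-distrib-+ d _ _)) ⟩
      a ℤ.* f d ℤ.+ g d ℤ.+ (∑ d (λ i → a ℤ.* (β i ℤ.* f i)) ℤ.+ ∑ d (λ i → β i ℤ.* g i))
    ≡⟨ cong (λ v → a ℤ.* f d ℤ.+ g d ℤ.+ (v ℤ.+ ∑ d (λ i → β i ℤ.* g i))) (∑-distribˡ-* d a _) ⟩
      a ℤ.* f d ℤ.+ g d ℤ.+ (a ℤ.* ∑ d (λ i → β i ℤ.* f i) ℤ.+ ∑ d (λ i → β i ℤ.* g i))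
    ≡⟨ regroup a (f d) (g d) _ _ ⟩
      a ℤ.* B⟨ f ⟩ ℤ.+ B⟨ g ⟩ ∎
    where
    open ≡-Reasoning
    distribute : ∀ b a x y → b ℤ.* (a ℤ.* x ℤ.+ y) ≡ a ℤ.* (b ℤ.* x) ℤ.+ b ℤ.* y
    distribute = solve-∀
    regroup : ∀ a x y u v → a ℤ.* x ℤ.+ y ℤ.+ (a ℤ.* u ℤ.+ v) ≡ a ℤ.* (x ℤ.+ u) ℤ.+ (y ℤ.+ v)
    regroup = solve-∀

  Bval : ℕ → ℤ
  Bval X = B⟨ (λ i → + (X ^ i)) ⟩

  Aval : ℕ → (ℕ → ℕ) → ℤ
  Aval X t = B⟨ (λ i → + horner X t i) ⟩

  IsSolution : (ℕ → ℕ) → Set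
  IsSolution t = ∀ n → B⟨ (λ i → + t (n + i)) ⟩ ≡ + 0

  recurrence⇒isSolution : ∀ {s} → Recurrence d α s → IsSolution s
  recurrence⇒isSolution {s} rec n = trans (cong (ℤ._+_ (+ s (n + d))) reindex) (rec n)
    where
    open ≡-Reasoning
    term : ℕ → ℤ
    term k = α (suc k) ℤ.* + s (n + d ∸ suc k)
    reflect : ∀ {i} → i < d → d ∸ i ≡ suc (d ∸ suc i)
    reflect i<d = +-∸-assoc 1 i<d
    reflected-term : ∀ {i} → i < d → β i ℤ.* + s (n + i) ≡ term (d ∸ suc i)
    reflected-term {i} i<d = cong₂ (λ a b → α a ℤ.* + s b) (reflect i<d) (begin
        n + i
      ≡⟨ cong (_+_ n) (m∸[m∸n]≡n (<⇒≤ i<d)) ⟨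
        n + (d ∸ (d ∸ i))
      ≡⟨ +-∸-assoc n (m∸n≤m d i) ⟨
        n + d ∸ (d ∸ i)
      ≡⟨ cong (n + d ∸_) (reflect i<d) ⟩
        n + d ∸ suc (d ∸ suc i) ∎)
    reindex : ∑ d (λ i → β i ℤ.* + s (n + i)) ≡ sumℤ (map term (upTo d))
    reindex = begin
        ∑ d (λ i → β i ℤ.* + s (n + i))
      ≡⟨ ∑-cong d reflected-term ⟩
        ∑ d (λ i → term (d ∸ suc i))
      ≡⟨ ∑-reverse d term ⟨
        ∑ d term
      ≡⟨ cong sumℤ (map-upTo term d) ⟨
        sumℤ (map term (upTo d)) ∎

  evalP-Bpoly : ∀ X → evalP (Bpoly d α) (+ X) ≡ Bval X
  evalP-Bpoly X = begin
      evalP (map β (upTo d) ++ + 1 ∷ []) (+ X)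
    ≡⟨ cong (λ p → evalP (p ++ + 1 ∷ []) (+ X)) (map-upTo β d) ⟩
      evalP (applyUpTo β d ++ + 1 ∷ []) (+ X)
    ≡⟨ evalP-applyUpTo-++ X d β (+ 1 ∷ []) ⟩
      ∑ d (λ i → β i ℤ.* + (X ^ i)) ℤ.+ + (X ^ d) ℤ.* (+ 1 ℤ.+ + X ℤ.* + 0)
    ≡⟨ regroup (∑ d (λ i → β i ℤ.* + (X ^ i))) (+ (X ^ d)) (+ X) ⟩
      Bval X ∎
    where
    open ≡-Reasoning
    regroup : ∀ u p x → u ℤ.+ p ℤ.* (+ 1 ℤ.+ x ℤ.* + 0) ≡ p ℤ.+ u
    regroup = solve-∀

  evalP-drop-Spoly-≤ : ∀ X s {i} → i ≤ d → evalP (drop (d ∸ i) (Spoly d s)) (+ X) ≡ + horner X s i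
  evalP-drop-Spoly-≤ X s {i} i≤d =
    subst (λ m → evalP (drop (d ∸ i) (Spoly m s)) (+ X) ≡ + horner X s i) (m∸n+n≡m i≤d)
          (evalP-drop-Spoly (d ∸ i) i s X)

  evalP-Apoly : ∀ X s → evalP (Apoly d α s) (+ X) ≡ Aval X s
  evalP-Apoly X s = begin
      evalP (drop d (mulP (map β (upTo d) ++ + 1 ∷ []) (Spoly d s))) (+ X)
    ≡⟨ cong (λ p → evalP (drop d (mulP (p ++ + 1 ∷ []) (Spoly d s))) (+ X)) (map-upTo β d) ⟩
      evalP (drop d (mulP (applyUpTo β d ++ + 1 ∷ []) (Spoly d s))) (+ X)
    ≡⟨ evalP-drop-mulP d β (+ 1) (Spoly d s) (+ X) ⟩
      ∑ d (λ i → β i ℤ.* evalP (drop (d ∸ i) (Spoly d s)) (+ X)) ℤ.+ + 1 ℤ.* evalP (Spoly d s) (+ X)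
    ≡⟨ cong₂ ℤ._+_ (∑-cong d (λ {i} i<d → cong (β i ℤ.*_) (evalP-drop-Spoly-≤ X s (<⇒≤ i<d))))
                   (trans (ℤₚ.*-identityˡ _) (evalP-drop-Spoly 0 d s X)) ⟩
      ∑ d (λ i → β i ℤ.* + horner X s i) ℤ.+ + horner X s d
    ≡⟨ ℤₚ.+-comm (∑ d (λ i → β i ℤ.* + horner X s i)) (+ horner X s d) ⟩
      Aval X s ∎
    where open ≡-Reasoning

  Aval-shift : ∀ X t → B⟨ (λ i → + t i) ⟩ ≡ + 0 → + X ℤ.* Aval X t ≡ + t 0 ℤ.* Bval X ℤ.+ Aval X (t ∘ suc)
  Aval-shift X t B⟨t⟩≡0 = begin
      + X ℤ.* Aval X t
    ≡⟨ ℤₚ.+-identityʳ _ ⟨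
      + X ℤ.* Aval X t ℤ.+ + 0
    ≡⟨ cong (ℤ._+_ (+ X ℤ.* Aval X t)) B⟨t⟩≡0 ⟨
      + X ℤ.* Aval X t ℤ.+ B⟨ (λ i → + t i) ⟩
    ≡⟨ B⟨⟩-linear (+ X) _ _ ⟨
      B⟨ (λ i → + X ℤ.* + horner X t i ℤ.+ + t i) ⟩
    ≡⟨ B⟨⟩-cong (λ i → trans (sym (pos-*-+ X _ _)) (trans (cong +_ (horner-shift X t i)) (pos-*-+ (t 0) _ _))) ⟩
      B⟨ (λ i → + t 0 ℤ.* + (X ^ i) ℤ.+ + horner X (t ∘ suc) i) ⟩
    ≡⟨ B⟨⟩-linear (+ t 0) _ _ ⟩
      + t 0 ℤ.* Bval X ℤ.+ Aval X (t ∘ suc) ∎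
    where open ≡-Reasoning

  Aval-iterate : ∀ X t → IsSolution t → ∀ m →
                 + (X ^ m) ℤ.* Aval X t ≡ + horner X t m ℤ.* Bval X ℤ.+ Aval X (λ k → t (m + k))
  Aval-iterate X t sol zero = start (Aval X t) (Bval X)
    where
    start : ∀ a b → + 1 ℤ.* a ≡ + 0 ℤ.* b ℤ.+ a
    start = solve-∀
  Aval-iterate X t sol (suc m) = begin
      + (X * X ^ m) ℤ.* Aval X t
    ≡⟨ trans (cong (ℤ._* Aval X t) (ℤₚ.pos-* X (X ^ m))) (commute (+ X) (+ (X ^ m)) (Aval X t)) ⟩
      + (X ^ m) ℤ.* (+ X ℤ.* Aval X t)
    ≡⟨ cong (ℤ._*_ (+ (X ^ m))) (Aval-shift X t (sol 0)) ⟩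
      + (X ^ m) ℤ.* (+ t 0 ℤ.* Bval X ℤ.+ Aval X (t ∘ suc))
    ≡⟨ ℤₚ.*-distribˡ-+ (+ (X ^ m)) _ _ ⟩
      + (X ^ m) ℤ.* (+ t 0 ℤ.* Bval X) ℤ.+ + (X ^ m) ℤ.* Aval X (t ∘ suc)
    ≡⟨ cong (ℤ._+_ (+ (X ^ m) ℤ.* (+ t 0 ℤ.* Bval X))) (Aval-iterate X (t ∘ suc) (sol ∘ suc) m) ⟩
      + (X ^ m) ℤ.* (+ t 0 ℤ.* Bval X) ℤ.+ (+ horner X (t ∘ suc) m ℤ.* Bval X ℤ.+ Aval X (λ k → t (suc m + k)))
    ≡⟨ regroup (+ (X ^ m)) (+ t 0) (Bval X) (+ horner X (t ∘ suc) m) _ ⟩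
      (+ t 0 ℤ.* + (X ^ m) ℤ.+ + horner X (t ∘ suc) m) ℤ.* Bval X ℤ.+ Aval X (λ k → t (suc m + k))
    ≡⟨ cong (λ h → h ℤ.* Bval X ℤ.+ Aval X (λ k → t (suc m + k)))
            (trans (sym (pos-*-+ (t 0) (X ^ m) _)) (cong +_ (sym (horner-shift X t m)))) ⟩
      + horner X t (suc m) ℤ.* Bval X ℤ.+ Aval X (λ k → t (suc m + k)) ∎
    where
    open ≡-Reasoning
    commute : ∀ x p a → x ℤ.* p ℤ.* a ≡ p ℤ.* (x ℤ.* a)
    commute = solve-∀
    regroup : ∀ p c b h a → p ℤ.* (c ℤ.* b) ℤ.+ (h ℤ.* b ℤ.+ a) ≡ (c ℤ.* p ℤ.+ h) ℤ.* b ℤ.+ a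
    regroup = solve-∀

  ‖β‖ : ℕ
  ‖β‖ = ∑ℕ d (λ i → ∣ β i ∣)

  solution-≤ : ∀ {t G} → IsSolution t → ∀ n → (∀ {i} → i < d → t (n + i) ≤ G) → t (n + d) ≤ ‖β‖ * G
  solution-≤ {t} {G} sol n t≤G = begin
      t (n + d)
    ≡⟨ cong ∣_∣ (inverseˡ-unique (+ t (n + d)) S (sol n)) ⟩
      ∣ ℤ.- S ∣
    ≡⟨ ℤₚ.∣-i∣≡∣i∣ S ⟩
      ∣ S ∣
    ≤⟨ ∣∑*∣≤∑∣∣* d β (λ i → t (n + i)) t≤G ⟩
      ‖β‖ * G ∎
    where
    open ≤-Reasoning
    S = ∑ d (λ i → β i ℤ.* + t (n + i))

module _ (e : ℕ) (α : ℕ → ℤ) where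
  open LinearRecurrence (suc e) α

  solution-growth : ∀ {s} → IsSolution s → ∀ k → s k ≤ suc (∑ℕ (suc e) s) * suc ‖β‖ ^ k
  solution-growth {s} sol = <-rec (λ k → s k ≤ M * L ^ k) bound
    where
    M L : ℕ
    M = suc (∑ℕ (suc e) s)
    L = suc ‖β‖
    bound : ∀ k → (∀ {j} → j < k → s j ≤ M * L ^ j) → s k ≤ M * L ^ k
    bound k ih with k <? suc e
    ... | yes k<d = ≤-trans (≤-∑ℕ s k<d) (≤-trans (n≤1+n _) (m≤m*n M (L ^ k) {{m^n≢0 L k}}))
    ... | no k≮d = subst (λ j → s j ≤ M * L ^ j) n+d≡k (begin
        s (n + suc e)
      ≤⟨ solution-≤ {s} sol n earlier ⟩
        ‖β‖ * (M * L ^ (n + e))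
      ≤⟨ *-monoˡ-≤ (M * L ^ (n + e)) (n≤1+n ‖β‖) ⟩
        L * (M * L ^ (n + e))
      ≡⟨ x∙yz≈y∙xz L M (L ^ (n + e)) ⟩
        M * L ^ suc (n + e)
      ≡⟨ cong (λ j → M * L ^ j) (+-suc n e) ⟨
        M * L ^ (n + suc e) ∎)
      where
      open ≤-Reasoning
      n = k ∸ suc e
      n+d≡k : n + suc e ≡ k
      n+d≡k = m∸n+n≡m (≮⇒≥ k≮d)
      earlier : ∀ {i} → i < suc e → s (n + i) ≤ M * L ^ (n + e)
      earlier {i} (s≤s i≤e) = ≤-trans (ih (subst (n + i <_) n+d≡k (+-monoʳ-< n (s≤s i≤e))))
                                      (*-monoʳ-≤ M (^-monoʳ-≤ L (+-monoʳ-≤ n i≤e)))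

module _ (e : ℕ) (α : ℕ → ℤ) where
  open LinearRecurrence (suc (suc e)) α

  Bval-leading : ∀ {X} → 1 ≤ X →
                 Σ ℤ λ F → Bval X ≡ + (X ^ suc (suc e)) ℤ.+ F × ∣ F ∣ ≤ ‖β‖ * X ^ suc e
  Bval-leading {X} 1≤X = ∑ (suc (suc e)) (λ i → β i ℤ.* + (X ^ i)) , refl ,
    ∣∑*∣≤∑∣∣* (suc (suc e)) β (X ^_) (λ { (s≤s i≤e) → ^-monoʳ-≤ X {{>-nonZero 1≤X}} i≤e })

  Aval-leading : ∀ {X G} t → 1 ≤ X → (∀ {k} → k ≤ suc (suc e) → t k ≤ G) →
                 Σ ℤ λ E → Aval X t ≡ + (t 0 * X ^ suc e) ℤ.+ E
                         × ∣ E ∣ ≤ suc ‖β‖ * (suc (suc e) * G * X ^ e)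
  Aval-leading {X} {G} t 1≤X t≤G = + horner X (t ∘ suc) (suc e) ℤ.+ S , split , bound
    where
    S : ℤ
    S = ∑ (suc (suc e)) (λ i → β i ℤ.* + horner X t i)
    split : Aval X t ≡ + (t 0 * X ^ suc e) ℤ.+ (+ horner X (t ∘ suc) (suc e) ℤ.+ S)
    split = begin
        + horner X t (suc (suc e)) ℤ.+ S
      ≡⟨ cong (λ h → + h ℤ.+ S) (horner-shift X t (suc e)) ⟩
        + (t 0 * X ^ suc e + horner X (t ∘ suc) (suc e)) ℤ.+ S
      ≡⟨ cong (ℤ._+ S) (ℤₚ.pos-+ (t 0 * X ^ suc e) (horner X (t ∘ suc) (suc e))) ⟩
        + (t 0 * X ^ suc e) ℤ.+ + horner X (t ∘ suc) (suc e) ℤ.+ S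
      ≡⟨ ℤₚ.+-assoc (+ (t 0 * X ^ suc e)) (+ horner X (t ∘ suc) (suc e)) S ⟩
        + (t 0 * X ^ suc e) ℤ.+ (+ horner X (t ∘ suc) (suc e) ℤ.+ S) ∎
      where open ≡-Reasoning
    D : ℕ
    D = suc (suc e) * G * X ^ e
    horner-≤D : ∀ {i} u → i ≤ suc e → (∀ {k} → k < i → u k ≤ G) → horner X u i ≤ D
    horner-≤D u i≤ u≤G = ≤-trans (horner-≤ u 1≤X i≤ u≤G) (*-monoˡ-≤ (X ^ e) (*-monoˡ-≤ G (m≤n⇒m≤1+n i≤)))
    bound : ∣ + horner X (t ∘ suc) (suc e) ℤ.+ S ∣ ≤ suc ‖β‖ * D
    bound = begin
        ∣ + horner X (t ∘ suc) (suc e) ℤ.+ S ∣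
      ≤⟨ ℤₚ.∣i+j∣≤∣i∣+∣j∣ (+ horner X (t ∘ suc) (suc e)) S ⟩
        horner X (t ∘ suc) (suc e) + ∣ S ∣
      ≤⟨ +-mono-≤ (horner-≤D (t ∘ suc) ≤-refl (λ k<d → t≤G (m≤n⇒m≤1+n k<d)))
                  (∣∑*∣≤∑∣∣* (suc (suc e)) β (horner X t) (λ { (s≤s i≤e) →
                    horner-≤D t i≤e (λ k<i → t≤G (≤-trans (<⇒≤ k<i) (m≤n⇒m≤1+n i≤e))) })) ⟩
        D + ‖β‖ * D ∎
      where open ≤-Reasoning

module Expansion (e : ℕ) (α : ℕ → ℤ) (s : ℕ → ℕ) (sol : LinearRecurrence.IsSolution (suc (suc e)) α s) where
  open LinearRecurrence (suc (suc e)) α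

  -- s n ≤ M L^n, and K L^n bounds s n, L and the non-leading part of A n (b^n);
  -- b ≥ b₀ makes K L^n < b^⌈n/2⌉.
  d L M K P b₀ : ℕ
  d  = suc (suc e)
  L  = suc ‖β‖
  M  = suc (∑ℕ d s)
  K  = L * d * M * L ^ d
  P  = K * L
  b₀ = 2 + P * P

  M≤K : M ≤ K
  M≤K = ≤-trans (m≤n*m M (L * d) {{m*n≢0 L d}}) (m≤m*n (L * d * M) (L ^ d) {{m^n≢0 L d}})

  L≤K : L ≤ K
  L≤K = ≤-trans (m≤m*n L d) (≤-trans (m≤m*n (L * d) M) (m≤m*n (L * d * M) (L ^ d) {{m^n≢0 L d}}))

  instance
    K-nonZero : NonZero K
    K-nonZero = >-nonZero (≤-trans (s≤s z≤n) L≤K)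
    P-nonZero : NonZero P
    P-nonZero = m*n≢0 K L

  module _ {b m : ℕ} (b₀≤b : b₀ ≤ b) where
    n X c R : ℕ
    n = 2 + m
    X = b ^ n
    c = b ^ ⌈ n /2⌉
    R = K * L ^ n

    instance
      b-nonZero : NonZero b
      b-nonZero = >-nonZero (≤-trans (s≤s z≤n) b₀≤b)

    1≤X : 1 ≤ X
    1≤X = m^n>0 b n

    R<c : R < c
    R<c = begin-strict
        K * L ^ n
      ≤⟨ *-monoˡ-≤ (L ^ n) (m≤m^[1+n] K (suc m)) ⟩
        K ^ n * L ^ n
      ≡⟨ ^-distribʳ-* K L n ⟨
        P ^ n
      ≤⟨ ^-monoʳ-≤ P n≤2⌈n/2⌉ ⟩
        P ^ (⌈ n /2⌉ + ⌈ n /2⌉)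
      ≡⟨ trans (^-distribˡ-+-* P ⌈ n /2⌉ ⌈ n /2⌉) (sym (^-distribʳ-* P P ⌈ n /2⌉)) ⟩
        (P * P) ^ ⌈ n /2⌉
      <⟨ ^-monoˡ-< ⌈ n /2⌉ (≤-trans (n≤1+n _) b₀≤b) ⟩
        c ∎
      where
      open ≤-Reasoning
      n≤2⌈n/2⌉ : n ≤ ⌈ n /2⌉ + ⌈ n /2⌉
      n≤2⌈n/2⌉ = ≤-trans (≤-reflexive (sym (⌊n/2⌋+⌈n/2⌉≡n n))) (+-monoˡ-≤ ⌈ n /2⌉ (⌊n/2⌋≤⌈n/2⌉ n))

    c+c≤X : c + c ≤ X
    c+c≤X = begin
        c + c
      ≡⟨ cong (_+_ c) (+-identityʳ c) ⟨
        2 * c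
      ≤⟨ *-monoˡ-≤ c (≤-trans (≤-trans (m≤m+n 2 (P * P)) b₀≤b) (m≤m^[1+n] b ⌊ m /2⌋)) ⟩
        b ^ ⌊ n /2⌋ * c
      ≡⟨ ^-distribˡ-+-* b ⌊ n /2⌋ ⌈ n /2⌉ ⟨
        b ^ (⌊ n /2⌋ + ⌈ n /2⌉)
      ≡⟨ cong (b ^_) (⌊n/2⌋+⌈n/2⌉≡n n) ⟩
        X ∎
      where open ≤-Reasoning

    sₙ+L≤X : s n + L ≤ X
    sₙ+L≤X = ≤-trans (+-mono-≤ (≤-trans sₙ≤R (<⇒≤ R<c)) (≤-trans L≤R (<⇒≤ R<c))) c+c≤X
      where
      sₙ≤R : s n ≤ R
      sₙ≤R = ≤-trans (solution-growth (suc e) α {s} sol n) (*-monoˡ-≤ (L ^ n) M≤K)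
      L≤R : L ≤ R
      L≤R = ≤-trans L≤K (m≤m*n K (L ^ n) {{m^n≢0 L n}})

    ‖β‖≤X : ‖β‖ ≤ X
    ‖β‖≤X = ≤-trans (n≤1+n ‖β‖) (≤-trans (m≤n+m L (s n)) sₙ+L≤X)

    Bval-large : Σ ℕ λ N → Bval X ≡ + N × suc (s n) * X ^ suc e ≤ N
    Bval-large =
      let F , B≡ , ∣F∣≤      = Bval-leading e α 1≤X
          N , N≡ , N≥ , _    = pos-+-small F (≤-trans ∣F∣≤ (*-monoˡ-≤ (X ^ suc e) ‖β‖≤X))
      in N , trans B≡ N≡ , (begin
        suc (s n) * X ^ suc e
      ≤⟨ m+n≤o⇒m≤o∸n (suc (s n) * X ^ suc e) (≤-trans (≤-reflexive regroup) (*-monoˡ-≤ (X ^ suc e) sₙ+L≤X)) ⟩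
        X ^ d ∸ ‖β‖ * X ^ suc e
      ≤⟨ ∸-monoʳ-≤ (X ^ d) ∣F∣≤ ⟩
        X ^ d ∸ ∣ F ∣
      ≤⟨ N≥ ⟩
        N ∎)
      where
      open ≤-Reasoning
      regroup : suc (s n) * X ^ suc e + ‖β‖ * X ^ suc e ≡ (s n + L) * X ^ suc e
      regroup = trans (sym (*-distribʳ-+ (X ^ suc e) (suc (s n)) ‖β‖)) (cong (_* X ^ suc e) (sym (+-suc (s n) ‖β‖)))

    G : ℕ
    G = M * L ^ (n + d)

    s[n+k]≤G : ∀ {k} → k ≤ d → s (n + k) ≤ G
    s[n+k]≤G k≤d = ≤-trans (solution-growth (suc e) α {s} sol (n + _))
                           (*-monoʳ-≤ M (^-monoʳ-≤ L (+-monoʳ-≤ n k≤d)))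

    L*dGX^e≡R*X^e : L * (d * G * X ^ e) ≡ R * X ^ e
    L*dGX^e≡R*X^e = trans (cong (λ p → L * (d * (M * p) * X ^ e)) (^-distribˡ-+-* L n d))
                          (regroup L d M (L ^ n) (L ^ d) (X ^ e))
      where
      regroup : ∀ L d M p q x → L * (d * (M * (p * q)) * x) ≡ L * d * M * q * p * x
      regroup = solveℕ-∀

    Aval-digit : Σ ℕ λ ρ → + (X ^ e * c) ℤ.+ Aval X (λ k → s (n + k)) ≡ + (s n * X ^ suc e + ρ) × ρ < X ^ suc e
    Aval-digit =
      let E , A≡ , ∣E∣≤ = Aval-leading e α (λ k → s (n + k)) 1≤X s[n+k]≤G
          ∣E∣≤R*X^e     = ≤-trans ∣E∣≤ (≤-reflexive L*dGX^e≡R*X^e)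
          ∣E∣≤X^e*c     = ≤-trans ∣E∣≤R*X^e (≤-trans (*-monoˡ-≤ (X ^ e) (<⇒≤ R<c)) (≤-reflexive (*-comm c (X ^ e))))
          ρ , ρ≡ , _ , ρ≤ = pos-+-small E ∣E∣≤X^e*c
      in ρ , (begin
        + (X ^ e * c) ℤ.+ Aval X (λ k → s (n + k))
      ≡⟨ cong (ℤ._+_ (+ (X ^ e * c))) A≡ ⟩
        + (X ^ e * c) ℤ.+ (+ (s (n + 0) * X ^ suc e) ℤ.+ E)
      ≡⟨ cong (λ k → + (X ^ e * c) ℤ.+ (+ (s k * X ^ suc e) ℤ.+ E)) (+-identityʳ n) ⟩
        + (X ^ e * c) ℤ.+ (+ (s n * X ^ suc e) ℤ.+ E)
      ≡⟨ swap (+ (X ^ e * c)) (+ (s n * X ^ suc e)) E ⟩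
        + (s n * X ^ suc e) ℤ.+ (+ (X ^ e * c) ℤ.+ E)
      ≡⟨ cong (ℤ._+_ (+ (s n * X ^ suc e))) ρ≡ ⟩
        + (s n * X ^ suc e) ℤ.+ + ρ
      ≡⟨ ℤₚ.pos-+ (s n * X ^ suc e) ρ ⟨
        + (s n * X ^ suc e + ρ) ∎) , (Nat.begin-strict
        ρ
      Nat.≤⟨ ρ≤ ⟩
        X ^ e * c + ∣ E ∣
      Nat.≤⟨ +-monoʳ-≤ (X ^ e * c) ∣E∣≤R*X^e ⟩
        X ^ e * c + R * X ^ e
      Nat.≡⟨ trans (cong (_+ R * X ^ e) (*-comm (X ^ e) c)) (sym (*-distribʳ-+ (X ^ e) c R)) ⟩
        (c + R) * X ^ e
      Nat.<⟨ *-monoˡ-< (X ^ e) {{m^n≢0 X e {{m^n≢0 b n}}}} (<-≤-trans (+-monoʳ-< c R<c) c+c≤X) ⟩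
        X ^ suc e Nat.∎)
      where
      open ≡-Reasoning
      module Nat = ≤-Reasoning
      swap : ∀ a b x → a ℤ.+ (b ℤ.+ x) ≡ b ℤ.+ (a ℤ.+ x)
      swap = solve-∀

    numerator : + (b ^ (n * e + ⌈ n /2⌉)) ℤ.+ + (b ^ (n * n)) ℤ.* evalP (Apoly d α s) (+ X)
                ≡ + horner X s n ℤ.* Bval X ℤ.+ (+ (X ^ e * c) ℤ.+ Aval X (λ k → s (n + k)))
    numerator = begin
        + (b ^ (n * e + ⌈ n /2⌉)) ℤ.+ + (b ^ (n * n)) ℤ.* evalP (Apoly d α s) (+ X)
      ≡⟨ cong₂ (λ p q → + p ℤ.+ + q ℤ.* evalP (Apoly d α s) (+ X))
               (trans (^-distribˡ-+-* b (n * e) ⌈ n /2⌉) (cong (_* c) (sym (^-*-assoc b n e))))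
               (sym (^-*-assoc b n n)) ⟩
        + (X ^ e * c) ℤ.+ + (X ^ n) ℤ.* evalP (Apoly d α s) (+ X)
      ≡⟨ cong (λ a → + (X ^ e * c) ℤ.+ + (X ^ n) ℤ.* a) (evalP-Apoly X s) ⟩
        + (X ^ e * c) ℤ.+ + (X ^ n) ℤ.* Aval X s
      ≡⟨ cong (ℤ._+_ (+ (X ^ e * c))) (Aval-iterate X s sol n) ⟩
        + (X ^ e * c) ℤ.+ (+ horner X s n ℤ.* Bval X ℤ.+ Aval X (λ k → s (n + k)))
      ≡⟨ swap (+ (X ^ e * c)) (+ horner X s n ℤ.* Bval X) (Aval X (λ k → s (n + k))) ⟩
        + horner X s n ℤ.* Bval X ℤ.+ (+ (X ^ e * c) ℤ.+ Aval X (λ k → s (n + k))) ∎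
      where
      open ≡-Reasoning
      swap : ∀ a b x → a ℤ.+ (b ℤ.+ x) ≡ b ℤ.+ (a ℤ.+ x)
      swap = solve-∀

    expansion-at : evalP (Bpoly d α) (+ X) ≢ + 0
                 × s n ≡ divℕ (modℤ (+ (b ^ (n * e + ⌈ n /2⌉)) ℤ.+ + (b ^ (n * n)) ℤ.* evalP (Apoly d α s) (+ X))
                                    (evalP (Bpoly d α) (+ X)))
                              (b ^ (n * suc e))
    expansion-at =
      let N , B≡N , N≥ = Bval-large
          ρ , digit≡ , ρ<X^[e+1] = Aval-digit
          digit<N : s n * X ^ suc e + ρ < N
          digit<N = <-≤-trans (+-monoʳ-< (s n * X ^ suc e) ρ<X^[e+1])
                              (≤-trans (≤-reflexive (+-comm (s n * X ^ suc e) (X ^ suc e))) N≥)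
          B≢0 : evalP (Bpoly d α) (+ X) ≢ + 0
          B≢0 B≡0 = <⇒≢ (≤-<-trans z≤n digit<N)
                        (sym (ℤₚ.+-injective (trans (sym (trans (evalP-Bpoly X) B≡N)) B≡0)))
      in B≢0 , sym (begin
        divℕ (modℤ (+ (b ^ (n * e + ⌈ n /2⌉)) ℤ.+ + (b ^ (n * n)) ℤ.* evalP (Apoly d α s) (+ X))
                   (evalP (Bpoly d α) (+ X)))
             (b ^ (n * suc e))
      ≡⟨ cong₂ (λ v B → divℕ (modℤ v B) (b ^ (n * suc e)))
               (trans numerator (cong₂ (λ B a → + horner X s n ℤ.* B ℤ.+ a) B≡N digit≡))
               (trans (evalP-Bpoly X) B≡N) ⟩
        divℕ (modℤ (+ horner X s n ℤ.* + N ℤ.+ + (s n * X ^ suc e + ρ)) (+ N)) (b ^ (n * suc e))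
      ≡⟨ cong (divℕ _) (sym (^-*-assoc b n (suc e))) ⟩
        divℕ (modℤ (+ horner X s n ℤ.* + N ℤ.+ + (s n * X ^ suc e + ρ)) (+ N)) (X ^ suc e)
      ≡⟨ mod-div-digit (horner X s n) (s n) ρ ρ<X^[e+1] digit<N ⟩
        s n ∎)
      where open ≡-Reasoning

  expansion : ∀ b → b ≥ b₀ → ∀ n → n ≥ 2 →
    (evalP (Bpoly d α) (+ (b ^ n)) ≢ + 0)
    × (s n ≡ divℕ (modℤ (+ (b ^ (n * (d ∸ 2) + ⌈ n /2⌉)) ℤ.+ + (b ^ (n * n)) ℤ.* evalP (Apoly d α s) (+ (b ^ n)))
                        (evalP (Bpoly d α) (+ (b ^ n))))
                  (b ^ (n * (d ∸ 1))))
  expansion b b₀≤b (suc (suc m)) _         = expansion-at {b} {m} b₀≤b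
  expansion b b₀≤b (suc zero)    (s≤s ())

theorem2 : (d : ℕ) → d ≥ 2 → (α : ℕ → ℤ) → α d ≢ + 0 → (s : ℕ → ℕ) →
    Recurrence d α s →
    Σ ℕ λ n₀ → Σ ℕ λ b₀ → ∀ b → b ≥ b₀ → ∀ n → n ≥ n₀ →
      (evalP (Bpoly d α) (+ (b ^ n)) ≢ + 0)
      × (s n ≡ divℕ (modℤ (+ (b ^ (n * (d ∸ 2) + ⌈ n /2⌉)) ℤ.+ + (b ^ (n * n)) ℤ.* evalP (Apoly d α s) (+ (b ^ n)))
                           (evalP (Bpoly d α) (+ (b ^ n))))
                     (b ^ (n * (d ∸ 1))))
theorem2 (suc (suc e)) (s≤s (s≤s z≤n)) α _ s rec = 2 , b₀ , expansion
  where open Expansion e α s (LinearRecurrence.recurrence⇒isSolution (suc (suc e)) α {s} rec)
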